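{- Let $\sigma$ be the morphism on $\{0,1,2\}^*$ defined by $\sigma(0)=01$, $\sigma(1)=12$, $\sigma(2)=20$. Define letters $d_k\in\{0,1,2\}$ for $k\geq -1$ by $d_k=0$ if $k\equiv 3,4 \pmod 6$, $d_k=1$ if $k\equiv 1,2\pmod 6$, $d_k=2$ if $k\equiv 0,5\pmod 6$; and define $c_\ell\in\{0,1,2\}$ for $\ell\geq1$ by $c_\ell\equiv \ell+1\pmod 3$. Then for all $\ell\geq 1$, \[|\sigma^\ell(d_\ell)|_2-|\sigma^\ell(d_\ell)|_0=1\quad\text{and}\quad |\sigma^\ell(c_\ell)|_2-|\sigma^\ell(c_\ell)|_0=0.\]
   Context: $\sigma^\ell$ denotes the $\ell$-th iterate of $\sigma$; $|w|_a$ is the number of occurrences of the letter $a$ in $w$. -}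

module Defs where

open import Data.Nat using (ℕ; zero; suc; _+_; _%_)
open import Data.Fin using (Fin; zero; suc; _≟_)
open import Data.List using (List; []; _∷_; concatMap; filter; length)

Letter : Set
Letter = Fin 3

l0 l1 l2 : Letter
l0 = zero
l1 = suc zero
l2 = suc (suc zero)

σ₁ : Letter → List Letter
σ₁ zero = l0 ∷ l1 ∷ []
σ₁ (suc zero) = l1 ∷ l2 ∷ []
σ₁ (suc (suc zero)) = l2 ∷ l0 ∷ []

σ : List Letter → List Letter
σ = concatMap σ₁

σ^ : ℕ → List Letter → List Letter
σ^ zero w = w
σ^ (suc n) w = σ (σ^ n w)

count : Letter → List Letter → ℕ
count a w = length (filter (_≟ a) w)

-- d_k by k mod 6 (only needed for k ≥ 1 here)
dByRes : ℕ → Letter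
dByRes 0 = l2
dByRes 1 = l1
dByRes 2 = l1
dByRes 3 = l0
dByRes 4 = l0
dByRes _ = l2

d : ℕ → Letter
d k = dByRes (k % 6)

cByRes : ℕ → Letter
cByRes 0 = l0
cByRes 1 = l1
cByRes _ = l2

c : ℕ → Letter
c ℓ = cByRes ((ℓ + 1) % 3)

module Submission where

-- Idea.  σ sends every letter a to the word a·(a+1) (letters read mod 3), so
-- for every word w and letter a the Parikh counts satisfy
--   |σ w|_a = |w|_a + |w|_{a-1}.
-- Write δ_a(w) = |w|_a - |w|_{a+1} ∈ ℤ.  The count identity gives the one-step
-- recurrence δ_a(σ w) = - δ_{a+1}(w); applying it twice gives
-- δ_a(σ² w) = δ_{a+2}(w), and three double steps give the period
-- δ_a(σ⁶ w) = δ_a(w).  The letters d_ℓ and c_ℓ are also 6-periodic in ℓ, so the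
-- quantities in the theorem, δ_2(σ^ℓ(d_ℓ)) and δ_2(σ^ℓ(c_ℓ)), are 6-periodic
-- in ℓ and are checked by evaluation for ℓ = 0,…,5.  The identities in fact
-- hold for every ℓ ≥ 0.

open import Defs
open import Data.Nat using (ℕ; suc; _≤_; _+_; _%_)
open import Data.Nat.Properties using (+-comm; +-commutativeSemigroup)
open import Data.Nat.DivMod using ([m+n]%n≡m%n; [m+kn]%n≡m%n)
open import Data.Integer using (ℤ; +_; _-_; -_) renaming (_+_ to _+ℤ_)
open import Data.Integer.Properties using (pos-+; neg-involutive)
open import Data.Integer.Tactic.RingSolver using (solve-∀)
open import Data.Fin using (zero; suc; _≟_)
open import Data.List using (List; []; _∷_; [_]; _++_; filter; length)
open import Data.List.Properties using (length-++; filter-++)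
open import Data.Product using (_×_; _,_)
open import Algebra.Properties.CommutativeSemigroup +-commutativeSemigroup
  using (interchange)
open import Relation.Binary.PropositionalEquality
  using (_≡_; refl; sym; trans; cong; cong₂; module ≡-Reasoning)
open ≡-Reasoning

next prev : Letter → Letter
next zero = l1
next (suc zero) = l2
next (suc (suc zero)) = l0
prev zero = l2
prev (suc zero) = l0
prev (suc (suc zero)) = l1

prev-next : ∀ a → prev (next a) ≡ a
prev-next zero = refl
prev-next (suc zero) = refl
prev-next (suc (suc zero)) = refl

next²≡prev : ∀ a → next (next a) ≡ prev a
next²≡prev zero = refl
next²≡prev (suc zero) = refl
next²≡prev (suc (suc zero)) = refl

next⁶≡id : ∀ a → next (next (next (next (next (next a))))) ≡ a
next⁶≡id zero = refl
next⁶≡id (suc zero) = refl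
next⁶≡id (suc (suc zero)) = refl

count-++ : ∀ a u v → count a (u ++ v) ≡ count a u + count a v
count-++ a u v = trans (cong length (filter-++ (_≟ a) u v)) (length-++ (filter (_≟ a) u))

count-σ₁ : ∀ a b → count a (σ₁ b) ≡ count a [ b ] + count (prev a) [ b ]
count-σ₁ zero zero = refl
count-σ₁ zero (suc zero) = refl
count-σ₁ zero (suc (suc zero)) = refl
count-σ₁ (suc zero) zero = refl
count-σ₁ (suc zero) (suc zero) = refl
count-σ₁ (suc zero) (suc (suc zero)) = refl
count-σ₁ (suc (suc zero)) zero = refl
count-σ₁ (suc (suc zero)) (suc zero) = refl
count-σ₁ (suc (suc zero)) (suc (suc zero)) = refl

count-σ : ∀ a w → count a (σ w) ≡ count a w + count (prev a) w
count-σ a [] = refl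
count-σ a (b ∷ w) = begin
  count a (σ₁ b ++ σ w)
    ≡⟨ count-++ a (σ₁ b) (σ w) ⟩
  count a (σ₁ b) + count a (σ w)
    ≡⟨ cong₂ _+_ (count-σ₁ a b) (count-σ a w) ⟩
  (count a [ b ] + count (prev a) [ b ]) + (count a w + count (prev a) w)
    ≡⟨ interchange (count a [ b ]) _ _ _ ⟩
  (count a [ b ] + count a w) + (count (prev a) [ b ] + count (prev a) w)
    ≡⟨ sym (cong₂ _+_ (count-++ a [ b ] w) (count-++ (prev a) [ b ] w)) ⟩
  count a (b ∷ w) + count (prev a) (b ∷ w) ∎

δ : Letter → List Letter → ℤ
δ a w = + count a w - + count (next a) w

δ-σ : ∀ a w → δ a (σ w) ≡ - δ (next a) w
δ-σ a w = begin
  + count a (σ w) - + count (next a) (σ w)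
    ≡⟨ cong₂ (λ x y → + x - + y) (count-σ a w) (count-σ (next a) w) ⟩
  + (ca + count (prev a) w) - + (cna + count (prev (next a)) w)
    ≡⟨ cong (λ b → + (ca + count (prev a) w) - + (cna + count b w)) (prev-next a) ⟩
  + (ca + count (prev a) w) - + (cna + ca)
    ≡⟨ cong₂ _-_ (pos-+ ca _) (pos-+ cna ca) ⟩
  (+ ca +ℤ + count (prev a) w) - (+ cna +ℤ + ca)
    ≡⟨ cancel (+ ca) (+ count (prev a) w) (+ cna) ⟩
  - (+ cna - + count (prev a) w)
    ≡⟨ cong (λ b → - (+ cna - + count b w)) (sym (next²≡prev a)) ⟩
  - δ (next a) w ∎
  where
  ca cna : ℕ
  ca = count a w
  cna = count (next a) w
  cancel : ∀ x y z → (x +ℤ y) - (z +ℤ x) ≡ - (z - y)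
  cancel = solve-∀

δ-σ² : ∀ a w → δ a (σ (σ w)) ≡ δ (next (next a)) w
δ-σ² a w = begin
  δ a (σ (σ w))                ≡⟨ δ-σ a (σ w) ⟩
  - δ (next a) (σ w)           ≡⟨ cong -_ (δ-σ (next a) w) ⟩
  - - δ (next (next a)) w      ≡⟨ neg-involutive _ ⟩
  δ (next (next a)) w ∎

δ-σ⁶ : ∀ a w → δ a (σ^ 6 w) ≡ δ a w
δ-σ⁶ a w = begin
  δ a (σ^ 6 w)                                            ≡⟨ δ-σ² a (σ^ 4 w) ⟩
  δ (next (next a)) (σ^ 4 w)                              ≡⟨ δ-σ² _ (σ^ 2 w) ⟩
  δ (next (next (next (next a)))) (σ^ 2 w)                ≡⟨ δ-σ² _ w ⟩
  δ (next (next (next (next (next (next a)))))) w         ≡⟨ cong (λ b → δ b w) (next⁶≡id a) ⟩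
  δ a w ∎

d-period : ∀ m → d (6 + m) ≡ d m
d-period m = cong dByRes (trans (cong (_% 6) (+-comm 6 m)) ([m+n]%n≡m%n m 6))

c-period : ∀ m → c (6 + m) ≡ c m
c-period m =
  cong cByRes (trans (cong (_% 3) (+-comm 6 (m + 1))) ([m+kn]%n≡m%n (m + 1) 2 3))

δ-shift : ∀ a m {x y} → x ≡ y → δ a (σ^ (6 + m) [ x ]) ≡ δ a (σ^ m [ y ])
δ-shift a m refl = δ-σ⁶ a (σ^ m [ _ ])

balance : ∀ ℓ → (δ l2 (σ^ ℓ [ d ℓ ]) ≡ + 1) × (δ l2 (σ^ ℓ [ c ℓ ]) ≡ + 0)
balance 0 = refl , refl
balance 1 = refl , refl
balance 2 = refl , refl
balance 3 = refl , refl
balance 4 = refl , refl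
balance 5 = refl , refl
balance (suc (suc (suc (suc (suc (suc m)))))) with balance m
... | dm , cm = trans (δ-shift l2 m (d-period m)) dm , trans (δ-shift l2 m (c-period m)) cm

lemma5 : (ℓ : ℕ) → 1 ≤ ℓ →
    ((+ count l2 (σ^ ℓ (d ℓ ∷ [])) - + count l0 (σ^ ℓ (d ℓ ∷ []))) ≡ + 1)
    × ((+ count l2 (σ^ ℓ (c ℓ ∷ [])) - + count l0 (σ^ ℓ (c ℓ ∷ []))) ≡ + 0)
lemma5 ℓ _ = balance ℓ
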